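{- For any graph $G=(V,E)$, \[ \mathrm{sfo}(G)=2^{|E|}\sum_{S\in\mathcal{I}(G)}\prod_{v\in S}\left(-(1/2)^{\deg_G(v)}\right). \]
   Context: An orientation of the edges of $G$ is sink-free if every vertex has at least one outgoing edge; $\mathrm{sfo}(G)$ denotes the number of sink-free orientations of $G$. $\mathcal{I}(G)$ is the collection of independent sets of $G$ (including the empty set), and $\deg_G(v)$ is the degree of $v$ in $G$. -}

module Defs where

open import Data.Bool using (Bool; true; false; _∧_; _∨_; not; if_then_else_)
open import Data.Nat as ℕ using (ℕ; zero; suc; _<ᵇ_; _≡ᵇ_)
open import Data.Fin using (Fin; toℕ)
open import Data.Fin.Properties using (_≟_)
open import Data.Product using (_×_; _,_; proj₁; proj₂)
open import Data.List using (List; []; _∷_; length; map; allFin; filterᵇ; cartesianProduct; foldr; zip)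
open import Data.Bool.ListAction using (any; all)
open import Data.Vec as Vec using (Vec; []; _∷_; toList; lookup)
open import Data.Rational as ℚ using (ℚ; ½; -_; _*_; _+_; 0ℚ; 1ℚ)
open import Relation.Binary.PropositionalEquality using (_≡_)
open import Relation.Nullary.Decidable using (⌊_⌋)

record Graph : Set where
  field
    n     : ℕ
    adj   : Fin n → Fin n → Bool
    sym   : ∀ u v → adj u v ≡ adj v u
    irref : ∀ v → adj v v ≡ false
open Graph public

-- The edge set E: each edge {u,v} listed once as (u,v) with u < v.
edges : (G : Graph) → List (Fin (n G) × Fin (n G))
edges G = filterᵇ (λ e → (toℕ (proj₁ e) <ᵇ toℕ (proj₂ e)) ∧ adj G (proj₁ e) (proj₂ e))
                  (cartesianProduct (allFin (n G)) (allFin (n G)))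

numEdges : Graph → ℕ
numEdges G = length (edges G)

deg : (G : Graph) → Fin (n G) → ℕ
deg G v = length (filterᵇ (adj G v) (allFin (n G)))

allVecs : (m : ℕ) → List (Vec Bool m)
allVecs zero = [] ∷ []
allVecs (suc m) = map (true ∷_) (allVecs m) Data.List.++ map (false ∷_) (allVecs m)

-- An orientation assigns to each edge (u,v) (u < v) a Boolean:
-- true means u → v, false means v → u.
Orientation : Graph → Set
Orientation G = Vec Bool (numEdges G)

tail : ∀ {m} → (Fin m × Fin m) × Bool → Fin m
tail ((u , v) , true)  = u
tail ((u , v) , false) = v

sinkFree : (G : Graph) → Orientation G → Bool
sinkFree G o = all (λ v → any (λ e → ⌊ tail e ≟ v ⌋) (zip (edges G) (toList o)))
                   (allFin (n G))

sfo : Graph → ℕ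
sfo G = length (filterᵇ (sinkFree G) (allVecs (numEdges G)))

Subset : Graph → Set
Subset G = Vec Bool (n G)

isIndependent : (G : Graph) → Subset G → Bool
isIndependent G S =
  all (λ u → all (λ v → not (lookup S u ∧ lookup S v ∧ adj G u v)) (allFin (n G)))
      (allFin (n G))

indepSets : (G : Graph) → List (Subset G)
indepSets G = filterᵇ (isIndependent G) (allVecs (n G))

_^ℚ_ : ℚ → ℕ → ℚ
q ^ℚ zero = 1ℚ
q ^ℚ suc k = q * (q ^ℚ k)

sumℚ : List ℚ → ℚ
sumℚ = foldr _+_ 0ℚ

prodℚ : List ℚ → ℚ
prodℚ = foldr _*_ 1ℚ

prodOver : (G : Graph) → Subset G → (Fin (n G) → ℚ) → ℚ
prodOver G S f = prodℚ (map f (filterᵇ (lookup S) (allFin (n G))))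

ℕtoℚ : ℕ → ℚ
ℕtoℚ k = ℚ._/_ (Data.Integer.+ k) 1
  where import Data.Integer

-- Writing [v has an out-edge] = 1 − [v is a sink] and expanding the product over all
-- vertices gives sfo(G) = Σ_S (−1)^|S| · #{orientations in which every vertex of S is a sink}.
-- Every vertex of S is a sink exactly when no edge has its tail in S, so this count
-- factorises over the edges: an edge contributes 2, 1 or 0 according as 0, 1 or 2 of its
-- ends lie in S. The count is therefore 0 unless S is independent, and then it is
-- 2^|E| · ∏_{v ∈ S} (1/2)^deg(v).
{-# OPTIONS --safe #-}
module Submission where

open import Defs hiding (sym)
open import Data.List using (map)
open import Data.Nat using (_^_)
open import Data.Rational using (ℚ; ½; -_; _*_)
open import Relation.Binary.PropositionalEquality using (_≡_)
open import Algebra.Bundles using (CommutativeMonoid)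
open import Data.Bool using (Bool; true; false; _∧_; not; if_then_else_; T)
open import Data.Bool.Properties using (if-eta)
open import Data.Empty using (⊥-elim)
open import Data.Fin using (Fin; zero; suc; toℕ)
open import Data.Fin.Properties using (_≟_; ≤-antisym)
import Data.Integer as ℤ
import Data.Integer.Properties as ℤ
open import Data.List
  using (List; []; _∷_; _++_; length; allFin; tabulate; filterᵇ; cartesianProduct; zip)
open import Data.List.Properties using (map-cong; map-∘)
open import Data.Bool.ListAction using (any; all)
open import Data.Nat as ℕ using (ℕ; zero; suc; _<ᵇ_)
import Data.Nat.Properties as ℕ
open import Data.Nat.Coprimality using (1-coprimeTo) renaming (sym to coprime-sym)
open import Data.Product using (_×_; _,_)
open import Data.Rational using (_+_; 0ℚ; 1ℚ; mkℚ)
open import Data.Rational.Properties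
  using ( normalize-coprime; /-cong; +-identityˡ; +-identityʳ; +-assoc; +-comm
        ; *-identityˡ; *-identityʳ; *-zeroˡ; *-zeroʳ; *-assoc
        ; *-distribˡ-+; *-distribʳ-+
        ; +-0-commutativeMonoid; *-1-commutativeMonoid; +-*-ring )
open import Data.Unit using (tt)
open import Data.Vec using (Vec; []; _∷_; toList; lookup)
open import Function using (_∘_)
open import Relation.Binary.PropositionalEquality
  using (refl; sym; trans; cong; cong₂; subst; module ≡-Reasoning)
open import Relation.Nullary.Decidable using (⌊_⌋; yes; no)

open import Algebra.Properties.Ring +-*-ring using (-1*x≈-x)
open import Algebra.Properties.CommutativeSemigroup
  (CommutativeMonoid.commutativeSemigroup +-0-commutativeMonoid)
  using () renaming (interchange to +-interchange)
open import Algebra.Properties.CommutativeSemigroup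
  (CommutativeMonoid.commutativeSemigroup *-1-commutativeMonoid)
  using (x∙yz≈y∙xz; x∙yz≈z∙xy) renaming (interchange to *-interchange)

ℕtoℚ≡mkℚ : ∀ k → ℕtoℚ k ≡ mkℚ (ℤ.+ k) 0 (coprime-sym (1-coprimeTo k))
ℕtoℚ≡mkℚ k = normalize-coprime (coprime-sym (1-coprimeTo k))

ℕtoℚ-+ : ∀ a b → ℕtoℚ (a ℕ.+ b) ≡ ℕtoℚ a + ℕtoℚ b
ℕtoℚ-+ a b rewrite ℕtoℚ≡mkℚ a | ℕtoℚ≡mkℚ b =
  /-cong {ℤ.+ (a ℕ.+ b)} (sym (cong₂ ℤ._+_ (ℤ.*-identityʳ (ℤ.+ a)) (ℤ.*-identityʳ (ℤ.+ b)))) refl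

ℕtoℚ-* : ∀ a b → ℕtoℚ (a ℕ.* b) ≡ ℕtoℚ a * ℕtoℚ b
ℕtoℚ-* a b rewrite ℕtoℚ≡mkℚ a | ℕtoℚ≡mkℚ b = /-cong {ℤ.+ (a ℕ.* b)} (ℤ.pos-* a b) refl

ℕtoℚ-^ : ∀ a k → ℕtoℚ (a ^ k) ≡ ℕtoℚ a ^ℚ k
ℕtoℚ-^ a zero    = refl
ℕtoℚ-^ a (suc k) = trans (ℕtoℚ-* a (a ^ k)) (cong (ℕtoℚ a *_) (ℕtoℚ-^ a k))

⟦_⟧ : Bool → ℚ
⟦ true  ⟧ = 1ℚ
⟦ false ⟧ = 0ℚ

½^⟦_⟧ : Bool → ℚ
½^⟦ b ⟧ = if b then ½ else 1ℚ

⟦⟧≡1-⟦not⟧ : ∀ b → ⟦ b ⟧ ≡ 1ℚ + - ⟦ not b ⟧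
⟦⟧≡1-⟦not⟧ true  = refl
⟦⟧≡1-⟦not⟧ false = refl

⟦not-∧-∧⟧ : ∀ a b c → ⟦ not (a ∧ b ∧ c) ⟧ ≡ (if c then ⟦ not (a ∧ b) ⟧ else 1ℚ)
⟦not-∧-∧⟧ false b     c     = sym (if-eta c)
⟦not-∧-∧⟧ true  false c     = sym (if-eta c)
⟦not-∧-∧⟧ true  true  true  = refl
⟦not-∧-∧⟧ true  true  false = refl

⟦not⟧+⟦not⟧ : ∀ a b →
  ⟦ not a ⟧ + ⟦ not b ⟧ ≡ ℕtoℚ 2 * ((½^⟦ a ⟧ * ½^⟦ b ⟧) * (⟦ not (a ∧ b) ⟧ * ⟦ not (b ∧ a) ⟧))
⟦not⟧+⟦not⟧ true  true  = refl
⟦not⟧+⟦not⟧ true  false = refl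
⟦not⟧+⟦not⟧ false true  = refl
⟦not⟧+⟦not⟧ false false = refl

if-* : ∀ b (x y : ℚ) →
  (if b then x * y else 1ℚ) ≡ (if b then x else 1ℚ) * (if b then y else 1ℚ)
if-* true  x y = refl
if-* false x y = refl

module _ {A : Set} where

  ℕtoℚ-length-filterᵇ : (p : A → Bool) (xs : List A) →
    ℕtoℚ (length (filterᵇ p xs)) ≡ sumℚ (map (⟦_⟧ ∘ p) xs)
  ℕtoℚ-length-filterᵇ p []       = refl
  ℕtoℚ-length-filterᵇ p (x ∷ xs) with p x
  ... | true  = trans (ℕtoℚ-+ 1 (length (filterᵇ p xs)))
                      (cong (1ℚ +_) (ℕtoℚ-length-filterᵇ p xs))
  ... | false = trans (ℕtoℚ-length-filterᵇ p xs) (sym (+-identityˡ _))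

  sumℚ-cong : {f g : A → ℚ} → (∀ x → f x ≡ g x) → (xs : List A) →
    sumℚ (map f xs) ≡ sumℚ (map g xs)
  sumℚ-cong f≗g xs = cong sumℚ (map-cong f≗g xs)

  prodℚ-cong : {f g : A → ℚ} → (∀ x → f x ≡ g x) → (xs : List A) →
    prodℚ (map f xs) ≡ prodℚ (map g xs)
  prodℚ-cong f≗g xs = cong prodℚ (map-cong f≗g xs)

  sumℚ-filterᵇ : (p : A → Bool) (f : A → ℚ) (xs : List A) →
    sumℚ (map f (filterᵇ p xs)) ≡ sumℚ (map (λ x → ⟦ p x ⟧ * f x) xs)
  sumℚ-filterᵇ p f []       = refl
  sumℚ-filterᵇ p f (x ∷ xs) with p x
  ... | true  = cong₂ _+_ (sym (*-identityˡ (f x))) (sumℚ-filterᵇ p f xs)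
  ... | false = begin
    sumℚ (map f (filterᵇ p xs))                          ≡⟨ sumℚ-filterᵇ p f xs ⟩
    sumℚ (map (λ x → ⟦ p x ⟧ * f x) xs)                  ≡⟨ sym (+-identityˡ _) ⟩
    0ℚ + sumℚ (map (λ x → ⟦ p x ⟧ * f x) xs)             ≡⟨ cong (_+ _) (sym (*-zeroˡ (f x))) ⟩
    0ℚ * f x + sumℚ (map (λ x → ⟦ p x ⟧ * f x) xs)       ∎
    where open ≡-Reasoning

  prodℚ-filterᵇ : (p : A → Bool) (f : A → ℚ) (xs : List A) →
    prodℚ (map f (filterᵇ p xs)) ≡ prodℚ (map (λ x → if p x then f x else 1ℚ) xs)
  prodℚ-filterᵇ p f []       = refl
  prodℚ-filterᵇ p f (x ∷ xs) with p x
  ... | true  = cong (f x *_) (prodℚ-filterᵇ p f xs)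
  ... | false = trans (prodℚ-filterᵇ p f xs) (sym (*-identityˡ _))

  *-distribˡ-sumℚ : (c : ℚ) (f : A → ℚ) (xs : List A) →
    sumℚ (map (λ x → c * f x) xs) ≡ c * sumℚ (map f xs)
  *-distribˡ-sumℚ c f []       = sym (*-zeroʳ c)
  *-distribˡ-sumℚ c f (x ∷ xs) =
    trans (cong (c * f x +_) (*-distribˡ-sumℚ c f xs)) (sym (*-distribˡ-+ c (f x) _))

  sumℚ-distrib-+ : (f g : A → ℚ) (xs : List A) →
    sumℚ (map (λ x → f x + g x) xs) ≡ sumℚ (map f xs) + sumℚ (map g xs)
  sumℚ-distrib-+ f g []       = refl
  sumℚ-distrib-+ f g (x ∷ xs) =
    trans (cong (f x + g x +_) (sumℚ-distrib-+ f g xs))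
          (+-interchange (f x) (g x) (sumℚ (map f xs)) (sumℚ (map g xs)))

  prodℚ-distrib-* : (f g : A → ℚ) (xs : List A) →
    prodℚ (map (λ x → f x * g x) xs) ≡ prodℚ (map f xs) * prodℚ (map g xs)
  prodℚ-distrib-* f g []       = refl
  prodℚ-distrib-* f g (x ∷ xs) =
    trans (cong (f x * g x *_) (prodℚ-distrib-* f g xs))
          (*-interchange (f x) (g x) (prodℚ (map f xs)) (prodℚ (map g xs)))

  sumℚ-++ : (f : A → ℚ) (xs ys : List A) →
    sumℚ (map f (xs ++ ys)) ≡ sumℚ (map f xs) + sumℚ (map f ys)
  sumℚ-++ f []       ys = sym (+-identityˡ _)
  sumℚ-++ f (x ∷ xs) ys = trans (cong (f x +_) (sumℚ-++ f xs ys)) (sym (+-assoc (f x) _ _))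

  prodℚ-++ : (f : A → ℚ) (xs ys : List A) →
    prodℚ (map f (xs ++ ys)) ≡ prodℚ (map f xs) * prodℚ (map f ys)
  prodℚ-++ f []       ys = sym (*-identityˡ _)
  prodℚ-++ f (x ∷ xs) ys = trans (cong (f x *_) (prodℚ-++ f xs ys)) (sym (*-assoc (f x) _ _))

  sumℚ-zeros : (xs : List A) → sumℚ (map (λ _ → 0ℚ) xs) ≡ 0ℚ
  sumℚ-zeros []       = refl
  sumℚ-zeros (x ∷ xs) = trans (+-identityˡ _) (sumℚ-zeros xs)

  prodℚ-const : (c : ℚ) (xs : List A) → prodℚ (map (λ _ → c) xs) ≡ c ^ℚ length xs
  prodℚ-const c []       = refl
  prodℚ-const c (x ∷ xs) = cong (c *_) (prodℚ-const c xs)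

  ⟦all⟧ : (p : A → Bool) (xs : List A) → ⟦ all p xs ⟧ ≡ prodℚ (map (⟦_⟧ ∘ p) xs)
  ⟦all⟧ p []       = refl
  ⟦all⟧ p (x ∷ xs) with p x
  ... | true  = trans (⟦all⟧ p xs) (sym (*-identityˡ (prodℚ (map (⟦_⟧ ∘ p) xs))))
  ... | false = sym (*-zeroˡ (prodℚ (map (⟦_⟧ ∘ p) xs)))

  ⟦not-any⟧ : (p : A → Bool) (xs : List A) →
    ⟦ not (any p xs) ⟧ ≡ prodℚ (map (λ x → ⟦ not (p x) ⟧) xs)
  ⟦not-any⟧ p []       = refl
  ⟦not-any⟧ p (x ∷ xs) with p x
  ... | true  = sym (*-zeroˡ (prodℚ (map (λ x → ⟦ not (p x) ⟧) xs)))
  ... | false =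
    trans (⟦not-any⟧ p xs) (sym (*-identityˡ (prodℚ (map (λ x → ⟦ not (p x) ⟧) xs))))

module _ {A B : Set} where

  sumℚ-swap : (F : A → B → ℚ) (xs : List A) (ys : List B) →
    sumℚ (map (λ x → sumℚ (map (F x) ys)) xs) ≡
      sumℚ (map (λ y → sumℚ (map (λ x → F x y) xs)) ys)
  sumℚ-swap F []       ys = sym (sumℚ-zeros ys)
  sumℚ-swap F (x ∷ xs) ys = trans (cong (sumℚ (map (F x) ys) +_) (sumℚ-swap F xs ys))
    (sym (sumℚ-distrib-+ (F x) (λ y → sumℚ (map (λ x → F x y) xs)) ys))

  prodℚ-cartesianProduct : (F : A × B → ℚ) (xs : List A) (ys : List B) →
    prodℚ (map F (cartesianProduct xs ys)) ≡
      prodℚ (map (λ x → prodℚ (map (λ y → F (x , y)) ys)) xs)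
  prodℚ-cartesianProduct F []       ys = refl
  prodℚ-cartesianProduct F (x ∷ xs) ys =
    trans (prodℚ-++ F (map (x ,_) ys) (cartesianProduct xs ys))
          (cong₂ _*_ (cong prodℚ (sym (map-∘ ys))) (prodℚ-cartesianProduct F xs ys))

∏ : ∀ {k} → (Fin k → ℚ) → ℚ
∏ {zero}  f = 1ℚ
∏ {suc k} f = f zero * ∏ (f ∘ suc)

∏-cong : ∀ {k} {f g : Fin k → ℚ} → (∀ i → f i ≡ g i) → ∏ f ≡ ∏ g
∏-cong {zero}  f≗g = refl
∏-cong {suc k} f≗g = cong₂ _*_ (f≗g zero) (∏-cong (f≗g ∘ suc))

∏-1 : ∀ k → ∏ {k} (λ _ → 1ℚ) ≡ 1ℚ
∏-1 zero    = refl
∏-1 (suc k) = trans (*-identityˡ _) (∏-1 k)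

∏-distrib-* : ∀ {k} (f g : Fin k → ℚ) → ∏ (λ i → f i * g i) ≡ ∏ f * ∏ g
∏-distrib-* {zero}  f g = refl
∏-distrib-* {suc k} f g = trans (cong (f zero * g zero *_) (∏-distrib-* (f ∘ suc) (g ∘ suc)))
  (*-interchange (f zero) (g zero) (∏ (f ∘ suc)) (∏ (g ∘ suc)))

∏-swap : ∀ {k l} (F : Fin k → Fin l → ℚ) → ∏ (λ i → ∏ (F i)) ≡ ∏ (λ j → ∏ (λ i → F i j))
∏-swap {zero}  {l} F = sym (∏-1 l)
∏-swap {suc k} F = trans (cong (∏ (F zero) *_) (∏-swap (F ∘ suc)))
  (sym (∏-distrib-* (F zero) (λ j → ∏ (λ i → F (suc i) j))))

prodℚ-tabulate : ∀ {A : Set} {k} (g : Fin k → A) (f : A → ℚ) →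
  prodℚ (map f (tabulate g)) ≡ ∏ (f ∘ g)
prodℚ-tabulate {k = zero}  g f = refl
prodℚ-tabulate {k = suc k} g f = cong (f (g zero) *_) (prodℚ-tabulate (g ∘ suc) f)

prodℚ-allFin : ∀ {k} (f : Fin k → ℚ) → prodℚ (map f (allFin k)) ≡ ∏ f
prodℚ-allFin f = prodℚ-tabulate (λ i → i) f

∏ₛ : ∀ {k} → (Fin k → Bool) → (Fin k → ℚ) → ℚ
∏ₛ s f = ∏ (λ i → if s i then f i else 1ℚ)

∏ₛ-cong : ∀ {k} (s : Fin k → Bool) {f g : Fin k → ℚ} → (∀ i → f i ≡ g i) →
  ∏ₛ s f ≡ ∏ₛ s g
∏ₛ-cong s f≗g = ∏-cong (λ i → cong (if s i then_else 1ℚ) (f≗g i))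

∏ₛ-1 : ∀ {k} (s : Fin k → Bool) → ∏ₛ s (λ _ → 1ℚ) ≡ 1ℚ
∏ₛ-1 {k} s = trans (∏-cong (λ i → if-eta (s i))) (∏-1 k)

∏ₛ-distrib-* : ∀ {k} (s : Fin k → Bool) (f g : Fin k → ℚ) →
  ∏ₛ s (λ i → f i * g i) ≡ ∏ₛ s f * ∏ₛ s g
∏ₛ-distrib-* s f g = trans (∏-cong (λ i → if-* (s i) (f i) (g i)))
  (∏-distrib-* (λ i → if s i then f i else 1ℚ) (λ i → if s i then g i else 1ℚ))

∏ₛ-prodℚ-swap : ∀ {A : Set} {k} (s : Fin k → Bool) (K : Fin k → A → ℚ) (xs : List A) →
  ∏ₛ s (λ i → prodℚ (map (K i) xs)) ≡ prodℚ (map (λ x → ∏ₛ s (λ i → K i x)) xs)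
∏ₛ-prodℚ-swap s K []       = ∏ₛ-1 s
∏ₛ-prodℚ-swap s K (x ∷ xs) =
  trans (∏ₛ-distrib-* s (λ i → K i x) (λ i → prodℚ (map (K i) xs)))
        (cong (∏ₛ s (λ i → K i x) *_) (∏ₛ-prodℚ-swap s K xs))

∏ₛ-neg : ∀ {k} (s : Fin k → Bool) (f : Fin k → ℚ) →
  ∏ₛ s (λ i → - f i) ≡ ∏ₛ s (λ _ → - 1ℚ) * ∏ₛ s f
∏ₛ-neg s f = trans (∏ₛ-cong s (sym ∘ -1*x≈-x ∘ f)) (∏ₛ-distrib-* s (λ _ → - 1ℚ) f)

prodℚ-filterᵇ-allFin : ∀ {k} (s : Fin k → Bool) (f : Fin k → ℚ) →
  prodℚ (map f (filterᵇ s (allFin k))) ≡ ∏ₛ s f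
prodℚ-filterᵇ-allFin {k} s f =
  trans (prodℚ-filterᵇ s f (allFin k)) (prodℚ-allFin (λ i → if s i then f i else 1ℚ))

∏ₛ-const : ∀ {k} (s : Fin k → Bool) (c : ℚ) →
  ∏ₛ s (λ _ → c) ≡ c ^ℚ length (filterᵇ s (allFin k))
∏ₛ-const {k} s c =
  trans (sym (prodℚ-filterᵇ-allFin s (λ _ → c))) (prodℚ-const c (filterᵇ s (allFin k)))

∏ₛ-≢ : ∀ {k} (s : Fin k → Bool) (w : Fin k) →
  ∏ₛ s (λ i → ⟦ not ⌊ w ≟ i ⌋ ⟧) ≡ ⟦ not (s w) ⟧
∏ₛ-≢ s zero    =
  trans (cong ((if s zero then 0ℚ else 1ℚ) *_) (∏ₛ-1 (s ∘ suc))) (excluded (s zero))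
  where
  excluded : ∀ b → (if b then 0ℚ else 1ℚ) * 1ℚ ≡ ⟦ not b ⟧
  excluded true  = refl
  excluded false = refl
∏ₛ-≢ s (suc w) = begin
  (if s zero then 1ℚ else 1ℚ) * ∏ₛ (s ∘ suc) (λ i → ⟦ not ⌊ suc w ≟ suc i ⌋ ⟧)
    ≡⟨ cong₂ _*_ (if-eta (s zero)) (∏ₛ-cong (s ∘ suc) (cong (⟦_⟧ ∘ not) ∘ suc≟suc w)) ⟩
  1ℚ * ∏ₛ (s ∘ suc) (λ i → ⟦ not ⌊ w ≟ i ⌋ ⟧)
    ≡⟨ *-identityˡ _ ⟩
  ∏ₛ (s ∘ suc) (λ i → ⟦ not ⌊ w ≟ i ⌋ ⟧)
    ≡⟨ ∏ₛ-≢ (s ∘ suc) w ⟩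
  ⟦ not (s (suc w)) ⟧ ∎
  where
  open ≡-Reasoning
  suc≟suc : ∀ {k} (w i : Fin k) → ⌊ suc w ≟ suc i ⌋ ≡ ⌊ w ≟ i ⌋
  suc≟suc w i with w ≟ i
  ... | yes _ = refl
  ... | no  _ = refl

sumℚ-allVecs-suc : ∀ {k} (F : Vec Bool (suc k) → ℚ) →
  sumℚ (map F (allVecs (suc k))) ≡
    sumℚ (map (F ∘ (true ∷_)) (allVecs k)) + sumℚ (map (F ∘ (false ∷_)) (allVecs k))
sumℚ-allVecs-suc {k} F =
  trans (sumℚ-++ F (map (true ∷_) (allVecs k)) (map (false ∷_) (allVecs k)))
        (cong₂ _+_ (cong sumℚ (sym (map-∘ (allVecs k)))) (cong sumℚ (sym (map-∘ (allVecs k)))))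

∏-1+-expand : ∀ {k} (f : Fin k → ℚ) →
  ∏ (λ i → 1ℚ + f i) ≡ sumℚ (map (λ S → ∏ₛ (lookup S) f) (allVecs k))
∏-1+-expand {zero}  f = refl
∏-1+-expand {suc k} f = begin
  (1ℚ + f zero) * ∏ (λ i → 1ℚ + f (suc i))
    ≡⟨ cong ((1ℚ + f zero) *_) (∏-1+-expand (f ∘ suc)) ⟩
  (1ℚ + f zero) * ΣP
    ≡⟨ *-distribʳ-+ ΣP 1ℚ (f zero) ⟩
  1ℚ * ΣP + f zero * ΣP
    ≡⟨ +-comm (1ℚ * ΣP) (f zero * ΣP) ⟩
  f zero * ΣP + 1ℚ * ΣP
    ≡⟨ sym (cong₂ _+_ (*-distribˡ-sumℚ (f zero) P (allVecs k))
                      (*-distribˡ-sumℚ 1ℚ P (allVecs k))) ⟩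
  sumℚ (map (λ S → f zero * P S) (allVecs k)) + sumℚ (map (λ S → 1ℚ * P S) (allVecs k))
    ≡⟨ sym (sumℚ-allVecs-suc (λ S → ∏ₛ (lookup S) f)) ⟩
  sumℚ (map (λ S → ∏ₛ (lookup S) f) (allVecs (suc k))) ∎
  where
  open ≡-Reasoning
  P : Vec Bool k → ℚ
  P S = ∏ₛ (lookup S) (f ∘ suc)
  ΣP : ℚ
  ΣP = sumℚ (map P (allVecs k))

sumℚ-allVecs-prodℚ-zip : ∀ {A : Set} (h : A × Bool → ℚ) (xs : List A) →
  sumℚ (map (λ o → prodℚ (map h (zip xs (toList o)))) (allVecs (length xs)))
    ≡ prodℚ (map (λ x → h (x , true) + h (x , false)) xs)
sumℚ-allVecs-prodℚ-zip h []       = +-identityʳ 1ℚ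
sumℚ-allVecs-prodℚ-zip h (x ∷ xs) = begin
  sumℚ (map (λ o → prodℚ (map h (zip (x ∷ xs) (toList o)))) (allVecs (suc (length xs))))
    ≡⟨ sumℚ-allVecs-suc {length xs} (λ o → prodℚ (map h (zip (x ∷ xs) (toList o)))) ⟩
  sumℚ (map (λ o → h (x , true) * P o) A) + sumℚ (map (λ o → h (x , false) * P o) A)
    ≡⟨ cong₂ _+_ (*-distribˡ-sumℚ (h (x , true)) P A) (*-distribˡ-sumℚ (h (x , false)) P A) ⟩
  h (x , true) * sumℚ (map P A) + h (x , false) * sumℚ (map P A)
    ≡⟨ sym (*-distribʳ-+ (sumℚ (map P A)) (h (x , true)) (h (x , false))) ⟩
  (h (x , true) + h (x , false)) * sumℚ (map P A)
    ≡⟨ cong ((h (x , true) + h (x , false)) *_) (sumℚ-allVecs-prodℚ-zip h xs) ⟩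
  (h (x , true) + h (x , false)) * prodℚ (map (λ x → h (x , true) + h (x , false)) xs) ∎
  where
  open ≡-Reasoning
  A : List (Vec Bool (length xs))
  A = allVecs (length xs)
  P : Vec Bool (length xs) → ℚ
  P o = prodℚ (map h (zip xs (toList o)))

∏∏-distrib-* : ∀ {k l} (F G : Fin k → Fin l → ℚ) →
  ∏ (λ i → ∏ (λ j → F i j * G i j)) ≡ ∏ (λ i → ∏ (F i)) * ∏ (λ i → ∏ (G i))
∏∏-distrib-* F G =
  trans (∏-cong (λ i → ∏-distrib-* (F i) (G i))) (∏-distrib-* (λ i → ∏ (F i)) (λ i → ∏ (G i)))

<ᵇ≡false⇒≥ : ∀ m n → (m <ᵇ n) ≡ false → n ℕ.≤ m
<ᵇ≡false⇒≥ m n m≮ᵇn = ℕ.≮⇒≥ (λ m<n → subst T m≮ᵇn (ℕ.<⇒<ᵇ m<n))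

∏∏-symmetrise : ∀ {k} (F : Fin k → Fin k → ℚ) → (∀ i → F i i ≡ 1ℚ) →
  ∏ (λ i → ∏ (F i)) ≡ ∏ (λ i → ∏ (λ j → if toℕ i <ᵇ toℕ j then F i j * F j i else 1ℚ))
∏∏-symmetrise F Fᵢᵢ≡1 = begin
  ∏ (λ i → ∏ (F i))
    ≡⟨ ∏-cong (λ i → ∏-cong (split i)) ⟩
  ∏ (λ i → ∏ (λ j → U i j * L i j))
    ≡⟨ ∏∏-distrib-* U L ⟩
  ∏ (λ i → ∏ (U i)) * ∏ (λ i → ∏ (L i))
    ≡⟨ cong (∏ (λ i → ∏ (U i)) *_) (∏-swap L) ⟩
  ∏ (λ i → ∏ (U i)) * ∏ (λ i → ∏ (λ j → L j i))
    ≡⟨ sym (∏∏-distrib-* U (λ i j → L j i)) ⟩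
  ∏ (λ i → ∏ (λ j → U i j * L j i))
    ≡⟨ sym (∏-cong (λ i → ∏-cong (λ j → if-* (toℕ i <ᵇ toℕ j) (F i j) (F j i)))) ⟩
  ∏ (λ i → ∏ (λ j → if toℕ i <ᵇ toℕ j then F i j * F j i else 1ℚ)) ∎
  where
  open ≡-Reasoning
  U L : Fin _ → Fin _ → ℚ
  U i j = if toℕ i <ᵇ toℕ j then F i j else 1ℚ
  L i j = if toℕ j <ᵇ toℕ i then F i j else 1ℚ
  split : ∀ i j → F i j ≡ U i j * L i j
  split i j with toℕ i <ᵇ toℕ j in i<j | toℕ j <ᵇ toℕ i in j<i
  ... | true  | true  = ⊥-elim (ℕ.<-asym (ℕ.<ᵇ⇒< (toℕ i) (toℕ j) (subst T (sym i<j) tt))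
                                  (ℕ.<ᵇ⇒< (toℕ j) (toℕ i) (subst T (sym j<i) tt)))
  ... | true  | false = sym (*-identityʳ (F i j))
  ... | false | true  = sym (*-identityˡ (F i j))
  ... | false | false =
    trans (cong (F i) (sym (≤-antisym (<ᵇ≡false⇒≥ (toℕ j) (toℕ i) j<i)
                                      (<ᵇ≡false⇒≥ (toℕ i) (toℕ j) i<j))))
          (Fᵢᵢ≡1 i)

module _ (G : Graph) where

  private
    V : Set
    V = Fin (n G)

  prodℚ-edges : (ψ : V × V → ℚ) →
    prodℚ (map ψ (edges G)) ≡
      ∏ (λ u → ∏ (λ v → if (toℕ u <ᵇ toℕ v) ∧ adj G u v then ψ (u , v) else 1ℚ))
  prodℚ-edges ψ = begin
    prodℚ (map ψ (edges G))
      ≡⟨ prodℚ-filterᵇ isEdge ψ (cartesianProduct (allFin (n G)) (allFin (n G))) ⟩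
    prodℚ (map ψ′ (cartesianProduct (allFin (n G)) (allFin (n G))))
      ≡⟨ prodℚ-cartesianProduct ψ′ (allFin (n G)) (allFin (n G)) ⟩
    prodℚ (map (λ u → prodℚ (map (λ v → ψ′ (u , v)) (allFin (n G)))) (allFin (n G)))
      ≡⟨ prodℚ-cong (λ u → prodℚ-allFin (λ v → ψ′ (u , v))) (allFin (n G)) ⟩
    prodℚ (map (λ u → ∏ (λ v → ψ′ (u , v))) (allFin (n G)))
      ≡⟨ prodℚ-allFin (λ u → ∏ (λ v → ψ′ (u , v))) ⟩
    ∏ (λ u → ∏ (λ v → ψ′ (u , v))) ∎
    where
    open ≡-Reasoning
    isEdge : V × V → Bool
    isEdge (u , v) = (toℕ u <ᵇ toℕ v) ∧ adj G u v
    ψ′ : V × V → ℚ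
    ψ′ e = if isEdge e then ψ e else 1ℚ

  ∏ₛ-adj≡prodℚ-edges : (F : V → V → ℚ) →
    ∏ (λ u → ∏ₛ (adj G u) (F u)) ≡ prodℚ (map (λ (u , v) → F u v * F v u) (edges G))
  ∏ₛ-adj≡prodℚ-edges F = begin
    ∏ (λ u → ∏ (F′ u))
      ≡⟨ ∏∏-symmetrise F′ (λ u → cong (if_then F u u else 1ℚ) (irref G u)) ⟩
    ∏ (λ u → ∏ (λ v → if toℕ u <ᵇ toℕ v then F′ u v * F′ v u else 1ℚ))
      ≡⟨ ∏-cong (λ u → ∏-cong (λ v → upper u v)) ⟩
    ∏ (λ u → ∏ (λ v → if (toℕ u <ᵇ toℕ v) ∧ adj G u v then F u v * F v u else 1ℚ))
      ≡⟨ sym (prodℚ-edges (λ (u , v) → F u v * F v u)) ⟩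
    prodℚ (map (λ (u , v) → F u v * F v u) (edges G)) ∎
    where
    open ≡-Reasoning
    F′ : V → V → ℚ
    F′ u v = if adj G u v then F u v else 1ℚ
    upper : ∀ u v → (if toℕ u <ᵇ toℕ v then F′ u v * F′ v u else 1ℚ) ≡
                    (if (toℕ u <ᵇ toℕ v) ∧ adj G u v then F u v * F v u else 1ℚ)
    upper u v with toℕ u <ᵇ toℕ v
    ... | false = refl
    ... | true  = trans (cong (λ b → F′ u v * (if b then F v u else 1ℚ)) (Graph.sym G v u))
                        (sym (if-* (adj G u v) (F u v) (F v u)))

  ∏ₛ-½^deg : (s : V → Bool) →
    ∏ₛ s (λ u → ½ ^ℚ deg G u) ≡ prodℚ (map (λ (u , v) → ½^⟦ s u ⟧ * ½^⟦ s v ⟧) (edges G))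
  ∏ₛ-½^deg s = trans (∏-cong vertex) (∏ₛ-adj≡prodℚ-edges (λ u _ → ½^⟦ s u ⟧))
    where
    vertex : ∀ u → (if s u then ½ ^ℚ deg G u else 1ℚ) ≡ ∏ₛ (adj G u) (λ _ → ½^⟦ s u ⟧)
    vertex u with s u
    ... | true  = sym (∏ₛ-const (adj G u) ½)
    ... | false = sym (∏ₛ-1 (adj G u))

  ⟦isIndependent⟧ : (S : Subset G) → let s = lookup S in
    ⟦ isIndependent G S ⟧ ≡
      prodℚ (map (λ (u , v) → ⟦ not (s u ∧ s v) ⟧ * ⟦ not (s v ∧ s u) ⟧) (edges G))
  ⟦isIndependent⟧ S = begin
    ⟦ isIndependent G S ⟧
      ≡⟨ ⟦all⟧ (λ u → all (noEdgeInS u) (allFin (n G))) (allFin (n G)) ⟩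
    prodℚ (map (λ u → ⟦ all (noEdgeInS u) (allFin (n G)) ⟧) (allFin (n G)))
      ≡⟨ prodℚ-allFin (λ u → ⟦ all (noEdgeInS u) (allFin (n G)) ⟧) ⟩
    ∏ (λ u → ⟦ all (noEdgeInS u) (allFin (n G)) ⟧)
      ≡⟨ ∏-cong (λ u → trans (⟦all⟧ (noEdgeInS u) (allFin (n G)))
                             (prodℚ-allFin (⟦_⟧ ∘ noEdgeInS u))) ⟩
    ∏ (λ u → ∏ (λ v → ⟦ not (s u ∧ s v ∧ adj G u v) ⟧))
      ≡⟨ ∏-cong (λ u → ∏-cong (λ v → ⟦not-∧-∧⟧ (s u) (s v) (adj G u v))) ⟩
    ∏ (λ u → ∏ₛ (adj G u) (λ v → ⟦ not (s u ∧ s v) ⟧))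
      ≡⟨ ∏ₛ-adj≡prodℚ-edges (λ u v → ⟦ not (s u ∧ s v) ⟧) ⟩
    prodℚ (map (λ (u , v) → ⟦ not (s u ∧ s v) ⟧ * ⟦ not (s v ∧ s u) ⟧) (edges G)) ∎
    where
    open ≡-Reasoning
    s : V → Bool
    s = lookup S
    noEdgeInS : V → V → Bool
    noEdgeInS u v = not (s u ∧ s v ∧ adj G u v)

  orientations : List (Orientation G)
  orientations = allVecs (numEdges G)

  hasOutEdge : Orientation G → V → Bool
  hasOutEdge o v = any (λ e → ⌊ tail e ≟ v ⌋) (zip (edges G) (toList o))

  isSink : Orientation G → V → Bool
  isSink o v = not (hasOutEdge o v)

  ⟦sinkFree⟧-expand : (o : Orientation G) →
    ⟦ sinkFree G o ⟧ ≡ sumℚ (map (λ S → ∏ₛ (lookup S) (λ v → - ⟦ isSink o v ⟧)) (allVecs (n G)))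
  ⟦sinkFree⟧-expand o = begin
    ⟦ all (hasOutEdge o) (allFin (n G)) ⟧
      ≡⟨ ⟦all⟧ (hasOutEdge o) (allFin (n G)) ⟩
    prodℚ (map (⟦_⟧ ∘ hasOutEdge o) (allFin (n G)))
      ≡⟨ prodℚ-allFin (⟦_⟧ ∘ hasOutEdge o) ⟩
    ∏ (⟦_⟧ ∘ hasOutEdge o)
      ≡⟨ ∏-cong (⟦⟧≡1-⟦not⟧ ∘ hasOutEdge o) ⟩
    ∏ (λ v → 1ℚ + - ⟦ isSink o v ⟧)
      ≡⟨ ∏-1+-expand (λ v → - ⟦ isSink o v ⟧) ⟩
    sumℚ (map (λ S → ∏ₛ (lookup S) (λ v → - ⟦ isSink o v ⟧)) (allVecs (n G))) ∎
    where open ≡-Reasoning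

  ∏ₛ-isSink : (s : V → Bool) (o : Orientation G) →
    ∏ₛ s (⟦_⟧ ∘ isSink o) ≡ prodℚ (map (λ e → ⟦ not (s (tail e)) ⟧) (zip (edges G) (toList o)))
  ∏ₛ-isSink s o = begin
    ∏ₛ s (⟦_⟧ ∘ isSink o)
      ≡⟨ ∏ₛ-cong s (λ v → ⟦not-any⟧ (λ e → ⌊ tail e ≟ v ⌋) Z) ⟩
    ∏ₛ s (λ v → prodℚ (map (λ e → ⟦ not ⌊ tail e ≟ v ⌋ ⟧) Z))
      ≡⟨ ∏ₛ-prodℚ-swap s (λ v e → ⟦ not ⌊ tail e ≟ v ⌋ ⟧) Z ⟩
    prodℚ (map (λ e → ∏ₛ s (λ v → ⟦ not ⌊ tail e ≟ v ⌋ ⟧)) Z)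
      ≡⟨ prodℚ-cong (λ e → ∏ₛ-≢ s (tail e)) Z ⟩
    prodℚ (map (λ e → ⟦ not (s (tail e)) ⟧) Z) ∎
    where
    open ≡-Reasoning
    Z : List ((V × V) × Bool)
    Z = zip (edges G) (toList o)

  sumℚ-∏ₛ-isSink : (S : Subset G) →
    sumℚ (map (λ o → ∏ₛ (lookup S) (⟦_⟧ ∘ isSink o)) orientations) ≡
      ℕtoℚ (2 ^ numEdges G) * (∏ₛ (lookup S) (λ v → ½ ^ℚ deg G v) * ⟦ isIndependent G S ⟧)
  sumℚ-∏ₛ-isSink S = begin
    sumℚ (map (λ o → ∏ₛ s (⟦_⟧ ∘ isSink o)) orientations)
      ≡⟨ sumℚ-cong (∏ₛ-isSink s) orientations ⟩
    sumℚ (map (λ o → prodℚ (map h (zip (edges G) (toList o)))) orientations)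
      ≡⟨ sumℚ-allVecs-prodℚ-zip h (edges G) ⟩
    prodℚ (map (λ (u , v) → ⟦ not (s u) ⟧ + ⟦ not (s v) ⟧) (edges G))
      ≡⟨ prodℚ-cong (λ (u , v) → ⟦not⟧+⟦not⟧ (s u) (s v)) (edges G) ⟩
    prodℚ (map (λ e → ℕtoℚ 2 * (φ e * χ e)) (edges G))
      ≡⟨ prodℚ-distrib-* (λ _ → ℕtoℚ 2) (λ e → φ e * χ e) (edges G) ⟩
    prodℚ (map (λ _ → ℕtoℚ 2) (edges G)) * prodℚ (map (λ e → φ e * χ e) (edges G))
      ≡⟨ cong₂ _*_ (trans (prodℚ-const (ℕtoℚ 2) (edges G)) (sym (ℕtoℚ-^ 2 (numEdges G))))
                   (prodℚ-distrib-* φ χ (edges G)) ⟩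
    ℕtoℚ (2 ^ numEdges G) * (prodℚ (map φ (edges G)) * prodℚ (map χ (edges G)))
      ≡⟨ sym (cong (ℕtoℚ (2 ^ numEdges G) *_) (cong₂ _*_ (∏ₛ-½^deg s) (⟦isIndependent⟧ S))) ⟩
    ℕtoℚ (2 ^ numEdges G) * (∏ₛ s (λ v → ½ ^ℚ deg G v) * ⟦ isIndependent G S ⟧) ∎
    where
    open ≡-Reasoning
    s : V → Bool
    s = lookup S
    h : (V × V) × Bool → ℚ
    h e = ⟦ not (s (tail e)) ⟧
    φ χ : V × V → ℚ
    φ (u , v) = ½^⟦ s u ⟧ * ½^⟦ s v ⟧
    χ (u , v) = ⟦ not (s u ∧ s v) ⟧ * ⟦ not (s v ∧ s u) ⟧

  sumℚ-signed-sinks : (S : Subset G) →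
    sumℚ (map (λ o → ∏ₛ (lookup S) (λ v → - ⟦ isSink o v ⟧)) orientations) ≡
      ℕtoℚ (2 ^ numEdges G) * (⟦ isIndependent G S ⟧ * prodOver G S (λ v → - (½ ^ℚ deg G v)))
  sumℚ-signed-sinks S = begin
    sumℚ (map (λ o → ∏ₛ s (λ v → - ⟦ isSink o v ⟧)) orientations)
      ≡⟨ sumℚ-cong (λ o → ∏ₛ-neg s (⟦_⟧ ∘ isSink o)) orientations ⟩
    sumℚ (map (λ o → σ * ∏ₛ s (⟦_⟧ ∘ isSink o)) orientations)
      ≡⟨ *-distribˡ-sumℚ σ (λ o → ∏ₛ s (⟦_⟧ ∘ isSink o)) orientations ⟩
    σ * sumℚ (map (λ o → ∏ₛ s (⟦_⟧ ∘ isSink o)) orientations)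
      ≡⟨ cong (σ *_) (sumℚ-∏ₛ-isSink S) ⟩
    σ * (2^|E| * (D * I))
      ≡⟨ x∙yz≈y∙xz σ 2^|E| (D * I) ⟩
    2^|E| * (σ * (D * I))
      ≡⟨ cong (2^|E| *_) (x∙yz≈z∙xy σ D I) ⟩
    2^|E| * (I * (σ * D))
      ≡⟨ cong (λ x → 2^|E| * (I * x)) σD≡prodOver ⟩
    2^|E| * (I * prodOver G S (λ v → - (½ ^ℚ deg G v))) ∎
    where
    open ≡-Reasoning
    s : V → Bool
    s = lookup S
    2^|E| σ D I : ℚ
    2^|E| = ℕtoℚ (2 ^ numEdges G)
    σ = ∏ₛ s (λ _ → - 1ℚ)
    D = ∏ₛ s (λ v → ½ ^ℚ deg G v)
    I = ⟦ isIndependent G S ⟧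
    σD≡prodOver : σ * D ≡ prodOver G S (λ v → - (½ ^ℚ deg G v))
    σD≡prodOver = sym (trans (prodℚ-filterᵇ-allFin s (λ v → - (½ ^ℚ deg G v)))
                             (∏ₛ-neg s (λ v → ½ ^ℚ deg G v)))

lemma1p3 : (G : Graph) →
    ℕtoℚ (sfo G) ≡
      ℕtoℚ (2 ^ numEdges G) *
        sumℚ (map (λ S → prodOver G S (λ v → - (½ ^ℚ deg G v))) (indepSets G))
lemma1p3 G = begin
  ℕtoℚ (sfo G)
    ≡⟨ ℕtoℚ-length-filterᵇ (sinkFree G) (orientations G) ⟩
  sumℚ (map (λ o → ⟦ sinkFree G o ⟧) (orientations G))
    ≡⟨ sumℚ-cong (⟦sinkFree⟧-expand G) (orientations G) ⟩
  sumℚ (map (λ o → sumℚ (map (λ S → signedSinks S o) subsets)) (orientations G))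
    ≡⟨ sumℚ-swap (λ o S → signedSinks S o) (orientations G) subsets ⟩
  sumℚ (map (λ S → sumℚ (map (signedSinks S) (orientations G))) subsets)
    ≡⟨ sumℚ-cong (sumℚ-signed-sinks G) subsets ⟩
  sumℚ (map (λ S → 2^|E| * (⟦ isIndependent G S ⟧ * weight S)) subsets)
    ≡⟨ *-distribˡ-sumℚ 2^|E| (λ S → ⟦ isIndependent G S ⟧ * weight S) subsets ⟩
  2^|E| * sumℚ (map (λ S → ⟦ isIndependent G S ⟧ * weight S) subsets)
    ≡⟨ cong (2^|E| *_) (sym (sumℚ-filterᵇ (isIndependent G) weight subsets)) ⟩
  2^|E| * sumℚ (map weight (indepSets G)) ∎
  where
  open ≡-Reasoning
  subsets : List (Subset G)
  subsets = allVecs (n G)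
  signedSinks : Subset G → Orientation G → ℚ
  signedSinks S o = ∏ₛ (lookup S) (λ v → - ⟦ isSink G o v ⟧)
  weight : Subset G → ℚ
  weight S = prodOver G S (λ v → - (½ ^ℚ deg G v))
  2^|E| : ℚ
  2^|E| = ℕtoℚ (2 ^ numEdges G)
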